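{- Let $G=(V,E)$ be a strongly connected graph and let $\pi=(\pi_1,\ldots,\pi_p)$ be an equitable partition of $G$, with quotient graph $G/\pi$. Let $Q=Q(G)$ and $\widehat{Q}=Q(G/\pi)$, and let $P$ be the $V\times\{1,\ldots,p\}$ matrix with $P_{vi}=1$ if $v\in\pi_i$ and $P_{vi}=0$ otherwise. Then the map $$\rho:\mathcal{K}^{*}(G/\pi)\to\mathcal{K}^{*}(G),\qquad \rho(\mathbf{x}+\widehat{Q}\mathbf{Z}^{p}):=P\mathbf{x}+Q\mathbf{Z}^{V},$$ is a well-defined injective group homomorphism.
   Context: A graph is a finite directed multigraph (loops and multiple edges allowed); an undirected edge is regarded as a pair of oppositely oriented directed edges. For a graph $G=(V,E)$, $A(G)$ is the $V\times V$ matrix whose $(v,w)$-entry is the number of directed edges with initial vertex $v$ and terminal vertex $w$; $\Delta(G)$ is the diagonal matrix with $\Delta_{vv}=\sum_{w}A_{vw}$ (outdegree of $v$); the Laplacian is $Q(G)=\Delta(G)-A(G)$. The dual critical group is $\mathcal{K}^{*}(G):=\mathbf{Z}^{V}/Q(G)\mathbf{Z}^{V}$. An ordered partition $\pi=(\pi_1,\ldots,\pi_p)$ of $V$ into nonempty blocks is equitable if there exist nonnegative integers $F_{ij},R_{ij}$ ($1\le i,j\le p$) such that every vertex of $\pi_i$ is the initial vertex of exactly $F_{ij}$ directed edges with terminal vertex in $\pi_j$, and every vertex of $\pi_j$ is the terminal vertex of exactly $R_{ij}$ directed edges with initial vertex in $\pi_i$. The quotient $G/\pi$ is the graph on vertex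 set $\{1,\ldots,p\}$ with adjacency matrix $F=(F_{ij})$. -}

module Defs where

open import Data.Nat as ℕ using (ℕ; zero; suc)
open import Data.Integer as ℤ using (ℤ; +_; _-_; _*_)
open import Data.Fin using (Fin; zero; suc; _≟_)
open import Data.Product using (Σ; ∃; _×_; _,_)
open import Relation.Nullary using (yes; no)
open import Relation.Binary.PropositionalEquality using (_≡_)

-- A finite directed multigraph on vertex set Fin n, given by its adjacency
-- matrix: A v w = number of directed edges from v to w.
Graph : ℕ → Set
Graph n = Fin n → Fin n → ℕ

∑ℕ : ∀ {n} → (Fin n → ℕ) → ℕ
∑ℕ {zero}  f = 0
∑ℕ {suc n} f = f zero ℕ.+ ∑ℕ (λ i → f (suc i))

∑ℤ : ∀ {n} → (Fin n → ℤ) → ℤ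
∑ℤ {zero}  f = + 0
∑ℤ {suc n} f = f zero ℤ.+ ∑ℤ (λ i → f (suc i))

data Reach {n : ℕ} (A : Graph n) : Fin n → Fin n → Set where
  here : ∀ {v} → Reach A v v
  step : ∀ {v u w} → ℕ.NonZero (A v u) → Reach A u w → Reach A v w

StronglyConnected : ∀ {n} → Graph n → Set
StronglyConnected {n} A = (v w : Fin n) → Reach A v w

outdeg : ∀ {n} → Graph n → Fin n → ℕ
outdeg A v = ∑ℕ (λ w → A v w)

laplacian : ∀ {n} → Graph n → Fin n → Fin n → ℤ
laplacian A v w with v ≟ w
... | yes _ = + outdeg A v - + A v w
... | no  _ = ℤ.0ℤ - + A v w

applyQ : ∀ {n} → Graph n → (Fin n → ℤ) → (Fin n → ℤ)
applyQ A y v = ∑ℤ (λ w → laplacian A v w * y w)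

InLaplacianImage : ∀ {n} → Graph n → (Fin n → ℤ) → Set
InLaplacianImage {n} A x = Σ (Fin n → ℤ) (λ y → ∀ v → x v ≡ applyQ A y v)

-- equivalence in the dual critical group K*(G) = Z^V / Q Z^V
_≈[_]_ : ∀ {n} → (Fin n → ℤ) → Graph n → (Fin n → ℤ) → Set
x ≈[ A ] x' = InLaplacianImage A (λ v → x v - x' v)

-- An ordered partition of Fin n into p nonempty blocks, given by the
-- block map b (v ∈ π_i iff b v ≡ i); nonemptiness = surjectivity.
Surjective : ∀ {n p} → (Fin n → Fin p) → Set
Surjective {n} {p} b = (i : Fin p) → Σ (Fin n) (λ v → b v ≡ i)

edgesInto : ∀ {n p} → Graph n → (Fin n → Fin p) → Fin n → Fin p → ℕ
edgesInto A b v j = ∑ℕ (λ w → [ b w ≟ j ]? A v w)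
  where
  [_]?_ : ∀ {P : Set} → Relation.Nullary.Dec P → ℕ → ℕ
  [ yes _ ]? k = k
  [ no  _ ]? k = 0

edgesFrom : ∀ {n p} → Graph n → (Fin n → Fin p) → Fin p → Fin n → ℕ
edgesFrom A b i w = ∑ℕ (λ v → [ b v ≟ i ]? A v w)
  where
  [_]?_ : ∀ {P : Set} → Relation.Nullary.Dec P → ℕ → ℕ
  [ yes _ ]? k = k
  [ no  _ ]? k = 0

IsEquitable : ∀ {n p} → Graph n → (Fin n → Fin p) →
              (F R : Fin p → Fin p → ℕ) → Set
IsEquitable {n} {p} A b F R =
  Surjective b ×
  ((i j : Fin p) (v : Fin n) → b v ≡ i → edgesInto A b v j ≡ F i j) ×
  ((i j : Fin p) (w : Fin n) → b w ≡ j → edgesFrom A b i w ≡ R i j)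

charMatrix : ∀ {n p} → (Fin n → Fin p) → Fin n → Fin p → ℤ
charMatrix b v i with b v ≟ i
... | yes _ = + 1
... | no  _ = + 0

applyP : ∀ {n p} → (Fin n → Fin p) → (Fin p → ℤ) → (Fin n → ℤ)
applyP b x v = ∑ℤ (λ i → charMatrix b v i * x i)

-- P intertwines the Laplacians, QP = PQ̂, because every vertex of π_i sends
-- exactly F_ij edges into π_j; this gives well-definedness.  For injectivity
-- let Px - Px' = Qy, so Qy is constant on blocks.  Subtracting from y its
-- minimum g_j over each block π_j leaves f = y - Pg ≥ 0, vanishing somewhere
-- in every block, with Qf = Qy - PQ̂g still constant on blocks.  At a global
-- maximum v of f we have (Qf)_v ≥ 0, and at a zero u of f in the block of v
-- we have (Qf)_u ≤ 0; as the two agree, (Qf)_v = 0 and every out-neighbour of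
-- v is a maximum too.  By strong connectivity f is constant, hence 0, so
-- y = Pg and x - x' = Q̂g.
{-# OPTIONS --safe #-}
module Submission where

open import Defs
open import Data.Nat using (ℕ)
open import Data.Integer using (ℤ; _+_)
open import Data.Fin using (Fin)
open import Data.Product using (_×_)
open import Relation.Binary.PropositionalEquality using (_≡_)

import Data.Nat as ℕ
import Data.Nat.Properties as ℕP
open import Data.Integer using (+_; _-_; _*_; -_; 0ℤ; 1ℤ; _≤_)
import Data.Integer.Properties as ℤP
open import Data.Integer.Tactic.RingSolver using (solve-∀)
open import Algebra.Properties.Semiring.Sum ℤP.+-*-semiring
  using (sum; sum-cong-≗; sum-remove; sum-replicate-zero; ∑-distrib-+; ∑-comm;
         *-distribʳ-sum)
open import Data.Fin using (zero; suc; _≟_; punchIn)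
open import Data.Fin.Properties using (punchInᵢ≢i)
open import Data.List using (List; allFin; filter)
open import Data.List.Membership.Propositional.Properties using (∈-allFin; ∈-filter⁺)
open import Data.List.Relation.Unary.All using (lookup)
open import Data.List.Relation.Unary.All.Properties using (all-filter)
import Data.List.Extrema ℤP.≤-totalOrder as Extrema
open import Data.Product using (∃; _,_; proj₁; proj₂)
open import Function using (id; _∘_)
open import Level using (0ℓ)
open import Relation.Nullary using (yes; no; contradiction)
open import Relation.Unary using (Pred; Decidable)
open import Relation.Binary.PropositionalEquality
  using (_≢_; refl; sym; trans; cong; cong₂; subst; module ≡-Reasoning)

∑ℤ≡sum : ∀ {n} (f : Fin n → ℤ) → ∑ℤ f ≡ sum f
∑ℤ≡sum {ℕ.zero}  f = refl
∑ℤ≡sum {ℕ.suc n} f = cong (_+_ (f zero)) (∑ℤ≡sum (f ∘ suc))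

+∑ℕ≡sum : ∀ {n} {f : Fin n → ℕ} {g : Fin n → ℤ} → (∀ i → + f i ≡ g i) → + ∑ℕ f ≡ sum g
+∑ℕ≡sum {ℕ.zero}          _   = refl
+∑ℕ≡sum {ℕ.suc n} {f} {g} f≗g =
  trans (ℤP.pos-+ (f zero) (∑ℕ (f ∘ suc))) (cong₂ _+_ (f≗g zero) (+∑ℕ≡sum (f≗g ∘ suc)))

sum-zero : ∀ {n} {f : Fin n → ℤ} → (∀ i → f i ≡ 0ℤ) → sum f ≡ 0ℤ
sum-zero {n} f≡0 = trans (sum-cong-≗ f≡0) (sum-replicate-zero n)

sum-single : ∀ {n} (k : Fin n) (f : Fin n → ℤ) → (∀ i → i ≢ k → f i ≡ 0ℤ) → sum f ≡ f k
sum-single {ℕ.suc n} k f f≡0 = begin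
  sum f                          ≡⟨ sum-remove f ⟩
  f k + sum (f ∘ punchIn k)      ≡⟨ cong (_+_ (f k)) (sum-zero (λ j → f≡0 _ (punchInᵢ≢i k j))) ⟩
  f k + 0ℤ                       ≡⟨ ℤP.+-identityʳ (f k) ⟩
  f k                            ∎
  where open ≡-Reasoning

sum-neg : ∀ {n} (f : Fin n → ℤ) → sum (λ i → - f i) ≡ - sum f
sum-neg {ℕ.zero}  f = refl
sum-neg {ℕ.suc n} f =
  trans (cong (_+_ (- f zero)) (sum-neg (f ∘ suc))) (sym (ℤP.neg-distrib-+ (f zero) _))

∑-distrib-minus : ∀ {n} (f g : Fin n → ℤ) → sum (λ i → f i - g i) ≡ sum f - sum g
∑-distrib-minus f g = trans (∑-distrib-+ f (λ i → - g i)) (cong (_+_ (sum f)) (sum-neg g))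

sum-nonNeg : ∀ {n} {f : Fin n → ℤ} → (∀ i → 0ℤ ≤ f i) → 0ℤ ≤ sum f
sum-nonNeg {ℕ.zero}  _   = ℤP.≤-refl
sum-nonNeg {ℕ.suc n} f≥0 = ℤP.+-mono-≤ (f≥0 zero) (sum-nonNeg (f≥0 ∘ suc))

sum-nonPos : ∀ {n} {f : Fin n → ℤ} → (∀ i → f i ≤ 0ℤ) → sum f ≤ 0ℤ
sum-nonPos {ℕ.zero}  _   = ℤP.≤-refl
sum-nonPos {ℕ.suc n} f≤0 = ℤP.+-mono-≤ (f≤0 zero) (sum-nonPos (f≤0 ∘ suc))

nonNeg⇒f[i]≤sum : ∀ {n} {f : Fin n → ℤ} → (∀ i → 0ℤ ≤ f i) → ∀ i → f i ≤ sum f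
nonNeg⇒f[i]≤sum {ℕ.suc n} {f} f≥0 zero = begin
  f zero        ≡⟨ ℤP.+-identityʳ (f zero) ⟨
  f zero + 0ℤ   ≤⟨ ℤP.+-monoʳ-≤ (f zero) (sum-nonNeg (f≥0 ∘ suc)) ⟩
  sum f         ∎
  where open ℤP.≤-Reasoning
nonNeg⇒f[i]≤sum {ℕ.suc n} {f} f≥0 (suc i) = begin
  f (suc i)            ≤⟨ nonNeg⇒f[i]≤sum (f≥0 ∘ suc) i ⟩
  sum (f ∘ suc)        ≡⟨ ℤP.+-identityˡ (sum (f ∘ suc)) ⟨
  0ℤ + sum (f ∘ suc)   ≤⟨ ℤP.+-monoˡ-≤ (sum (f ∘ suc)) (f≥0 zero) ⟩
  sum f                ∎
  where open ℤP.≤-Reasoning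

charMatrix-≡ : ∀ {n p} (b : Fin n → Fin p) {v i} → b v ≡ i → charMatrix b v i ≡ 1ℤ
charMatrix-≡ b {v} {i} bv≡i with b v ≟ i
... | yes _    = refl
... | no bv≢i  = contradiction bv≡i bv≢i

charMatrix-≢ : ∀ {n p} (b : Fin n → Fin p) {v i} → b v ≢ i → charMatrix b v i ≡ 0ℤ
charMatrix-≢ b {v} {i} bv≢i with b v ≟ i
... | yes bv≡i = contradiction bv≡i bv≢i
... | no _     = refl

applyP-eval : ∀ {n p} (b : Fin n → Fin p) (x : Fin p → ℤ) v → applyP b x v ≡ x (b v)
applyP-eval b x v = begin
  applyP b x v                        ≡⟨ ∑ℤ≡sum (λ i → charMatrix b v i * x i) ⟩
  sum (λ i → charMatrix b v i * x i)  ≡⟨ sum-single (b v) _ off-block ⟩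
  charMatrix b v (b v) * x (b v)      ≡⟨ cong (_* x (b v)) (charMatrix-≡ b refl) ⟩
  1ℤ * x (b v)                        ≡⟨ ℤP.*-identityˡ (x (b v)) ⟩
  x (b v)                             ∎
  where
  open ≡-Reasoning
  off-block : ∀ i → i ≢ b v → charMatrix b v i * x i ≡ 0ℤ
  off-block i i≢bv = trans (cong (_* x i) (charMatrix-≢ b (i≢bv ∘ sym))) (ℤP.*-zeroˡ (x i))

applyP-distrib-+ : ∀ {n p} (b : Fin n → Fin p) (x y : Fin p → ℤ) v →
                   applyP b (λ i → x i + y i) v ≡ applyP b x v + applyP b y v
applyP-distrib-+ b x y v =
  trans (applyP-eval b _ v) (sym (cong₂ _+_ (applyP-eval b x v) (applyP-eval b y v)))

laplacian-entry : ∀ {n} (A : Graph n) v w →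
                  laplacian A v w ≡ charMatrix id v w * + outdeg A v - + A v w
laplacian-entry A v w with v ≟ w
... | yes _ = cong (_- + A v w) (sym (ℤP.*-identityˡ (+ outdeg A v)))
... | no _  = cong (_- + A v w) (sym (ℤP.*-zeroˡ (+ outdeg A v)))

[ab-c]d≡a[bd]-cd : ∀ a b c d → (a * b - c) * d ≡ a * (b * d) - c * d
[ab-c]d≡a[bd]-cd = solve-∀

ab-ac≡a[b-c] : ∀ a b c → a * b - a * c ≡ a * (b - c)
ab-ac≡a[b-c] = solve-∀

applyQ-as-differences : ∀ {n} (A : Graph n) (y : Fin n → ℤ) v →
                        applyQ A y v ≡ sum (λ w → + A v w * (y v - y w))
applyQ-as-differences A y v = begin
  applyQ A y v
    ≡⟨ ∑ℤ≡sum (λ w → laplacian A v w * y w) ⟩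
  sum (λ w → laplacian A v w * y w)
    ≡⟨ sum-cong-≗ (λ w → trans (cong (_* y w) (laplacian-entry A v w))
                              ([ab-c]d≡a[bd]-cd (charMatrix id v w) d (+ A v w) (y w))) ⟩
  sum (λ w → charMatrix id v w * (d * y w) - + A v w * y w)
    ≡⟨ ∑-distrib-minus (λ w → charMatrix id v w * (d * y w)) (λ w → + A v w * y w) ⟩
  sum (λ w → charMatrix id v w * (d * y w)) - ∑Ay
    ≡⟨ cong (_- ∑Ay) (trans (sym (∑ℤ≡sum (λ w → charMatrix id v w * (d * y w))))
                             (applyP-eval id (λ w → d * y w) v)) ⟩
  d * y v - ∑Ay
    ≡⟨ cong (λ t → t * y v - ∑Ay) (+∑ℕ≡sum {g = λ w → + A v w} (λ _ → refl)) ⟩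
  sum (λ w → + A v w) * y v - ∑Ay
    ≡⟨ cong (_- ∑Ay) (*-distribʳ-sum (y v) (λ w → + A v w)) ⟩
  sum (λ w → + A v w * y v) - ∑Ay
    ≡⟨ ∑-distrib-minus (λ w → + A v w * y v) (λ w → + A v w * y w) ⟨
  sum (λ w → + A v w * y v - + A v w * y w)
    ≡⟨ sum-cong-≗ (λ w → ab-ac≡a[b-c] (+ A v w) (y v) (y w)) ⟩
  sum (λ w → + A v w * (y v - y w))
    ∎
  where
  open ≡-Reasoning
  d : ℤ
  d = + outdeg A v
  ∑Ay : ℤ
  ∑Ay = sum (λ w → + A v w * y w)

applyQ-cong : ∀ {n} (A : Graph n) {y y′ : Fin n → ℤ} → (∀ w → y w ≡ y′ w) →
              ∀ v → applyQ A y v ≡ applyQ A y′ v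
applyQ-cong A {y} {y′} y≗y′ v = begin
  applyQ A y v                        ≡⟨ ∑ℤ≡sum (λ w → laplacian A v w * y w) ⟩
  sum (λ w → laplacian A v w * y w)   ≡⟨ sum-cong-≗ (λ w → cong (laplacian A v w *_) (y≗y′ w)) ⟩
  sum (λ w → laplacian A v w * y′ w)  ≡⟨ ∑ℤ≡sum (λ w → laplacian A v w * y′ w) ⟨
  applyQ A y′ v                       ∎
  where open ≡-Reasoning

applyQ-distrib-minus : ∀ {n} (A : Graph n) (y h : Fin n → ℤ) v →
                       applyQ A (λ w → y w - h w) v ≡ applyQ A y v - applyQ A h v
applyQ-distrib-minus A y h v = begin
  applyQ A (λ w → y w - h w) v
    ≡⟨ ∑ℤ≡sum (λ w → laplacian A v w * (y w - h w)) ⟩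
  sum (λ w → laplacian A v w * (y w - h w))
    ≡⟨ sum-cong-≗ (λ w → sym (ab-ac≡a[b-c] (laplacian A v w) (y w) (h w))) ⟩
  sum (λ w → laplacian A v w * y w - laplacian A v w * h w)
    ≡⟨ ∑-distrib-minus (λ w → laplacian A v w * y w) (λ w → laplacian A v w * h w) ⟩
  sum (λ w → laplacian A v w * y w) - sum (λ w → laplacian A v w * h w)
    ≡⟨ cong₂ _-_ (∑ℤ≡sum (λ w → laplacian A v w * y w)) (∑ℤ≡sum (λ w → laplacian A v w * h w)) ⟨
  applyQ A y v - applyQ A h v
    ∎
  where open ≡-Reasoning

-- The indicator inside edgesInto is local to Defs and cannot be named; its
-- instance on a one-vertex graph can, and conversion checking identifies all
-- instances because it skips their unused parameters.
edgesInto-one-vertex : ∀ {n p} (b : Fin n → Fin p) w j (k : ℕ) →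
                       + edgesInto {1} (λ _ _ → k) (λ _ → b w) zero j ≡ charMatrix b w j * + k
edgesInto-one-vertex b w j k with b w ≟ j
... | yes _ = trans (cong +_ (ℕP.+-identityʳ k)) (sym (ℤP.*-identityˡ (+ k)))
... | no _  = sym (ℤP.*-zeroˡ (+ k))

edgesInto-as-sum : ∀ {n p} (A : Graph n) (b : Fin n → Fin p) v j →
                   + edgesInto A b v j ≡ sum (λ w → charMatrix b w j * + A v w)
edgesInto-as-sum A b v j = +∑ℕ≡sum λ w →
  trans (cong +_ (sym (ℕP.+-identityʳ _))) (edgesInto-one-vertex b w j (A v w))

sum-by-blocks : ∀ {n p} (A : Graph n) (b : Fin n → Fin p) v (φ : Fin p → ℤ) →
                sum (λ w → + A v w * φ (b w)) ≡ sum (λ j → + edgesInto A b v j * φ j)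
sum-by-blocks A b v φ = begin
  sum (λ w → + A v w * φ (b w))
    ≡⟨ sum-cong-≗ (λ w → sym (applyP-eval b (λ j → + A v w * φ j) w)) ⟩
  sum (λ w → applyP b (λ j → + A v w * φ j) w)
    ≡⟨ sum-cong-≗ (λ w → ∑ℤ≡sum (λ j → charMatrix b w j * (+ A v w * φ j))) ⟩
  sum (λ w → sum (λ j → charMatrix b w j * (+ A v w * φ j)))
    ≡⟨ ∑-comm (λ w j → charMatrix b w j * (+ A v w * φ j)) ⟩
  sum (λ j → sum (λ w → charMatrix b w j * (+ A v w * φ j)))
    ≡⟨ sum-cong-≗ (λ j → sum-cong-≗ (λ w → sym (ℤP.*-assoc (charMatrix b w j) (+ A v w) (φ j)))) ⟩
  sum (λ j → sum (λ w → charMatrix b w j * + A v w * φ j))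
    ≡⟨ sum-cong-≗ (λ j → *-distribʳ-sum (φ j) (λ w → charMatrix b w j * + A v w)) ⟨
  sum (λ j → sum (λ w → charMatrix b w j * + A v w) * φ j)
    ≡⟨ sum-cong-≗ (λ j → cong (_* φ j) (edgesInto-as-sum A b v j)) ⟨
  sum (λ j → + edgesInto A b v j * φ j)
    ∎
  where open ≡-Reasoning

+a*-nonNeg : ∀ a {i} → 0ℤ ≤ i → 0ℤ ≤ + a * i
+a*-nonNeg a {i} 0≤i = subst (_≤ + a * i) (ℤP.*-zeroʳ (+ a)) (ℤP.*-monoˡ-≤-nonNeg (+ a) 0≤i)

+a*-nonPos : ∀ a {i} → i ≤ 0ℤ → + a * i ≤ 0ℤ
+a*-nonPos a {i} i≤0 = subst (+ a * i ≤_) (ℤP.*-zeroʳ (+ a)) (ℤP.*-monoˡ-≤-nonNeg (+ a) i≤0)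

applyQ-nonPos-at-min : ∀ {n} (A : Graph n) (f : Fin n → ℤ) {v} →
                       (∀ w → f v ≤ f w) → applyQ A f v ≤ 0ℤ
applyQ-nonPos-at-min A f {v} v-min =
  subst (_≤ 0ℤ) (sym (applyQ-as-differences A f v))
        (sum-nonPos (λ w → +a*-nonPos (A v w) (ℤP.i≤j⇒i-j≤0 (v-min w))))

max-propagates : ∀ {n} (A : Graph n) (f : Fin n → ℤ) {v w} →
                 (∀ u → f u ≤ f v) → applyQ A f v ≤ 0ℤ → ℕ.NonZero (A v w) → f w ≡ f v
max-propagates {n} A f {v} {w} v-max Qv≤0 A[v,w]≢0 =
  sym (ℤP.i-j≡0⇒i≡j (f v) (f w) (ℤP.*-cancelˡ-≡ (+ A v w) (f v - f w) 0ℤ {{A[v,w]≢0}} term≡0))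
  where
  term : Fin n → ℤ
  term u = + A v u * (f v - f u)
  term≥0 : ∀ u → 0ℤ ≤ term u
  term≥0 u = +a*-nonNeg (A v u) (ℤP.i≤j⇒0≤j-i (v-max u))
  term≤0 : term w ≤ 0ℤ
  term≤0 = ℤP.≤-trans (nonNeg⇒f[i]≤sum term≥0 w)
                      (subst (_≤ 0ℤ) (applyQ-as-differences A f v) Qv≤0)
  term≡0 : term w ≡ + A v w * 0ℤ
  term≡0 = trans (ℤP.≤-antisym term≤0 (term≥0 w)) (sym (ℤP.*-zeroʳ (+ A v w)))

Reach-preserves : ∀ {n} {A : Graph n} (P : Pred (Fin n) 0ℓ) →
                  (∀ {v w} → P v → ℕ.NonZero (A v w) → P w) →
                  ∀ {v w} → Reach A v w → P v → P w
Reach-preserves P P-closed here          Pv = Pv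
Reach-preserves P P-closed (step nz v⇝w) Pv = Reach-preserves P P-closed v⇝w (P-closed Pv nz)

argmax : ∀ {n} → Fin n → (f : Fin n → ℤ) → ∃ λ m → ∀ w → f w ≤ f m
argmax {n} v f = Extrema.argmax f v (allFin n) ,
  λ w → lookup (Extrema.f[xs]≤f[argmax] v (allFin n)) (∈-allFin w)

argmin-on : ∀ {n} {P : Pred (Fin n) 0ℓ} → Decidable P → (f : Fin n → ℤ) → ∃ P →
            ∃ λ m → P m × ∀ w → P w → f m ≤ f w
argmin-on {n} P? f (s , Ps) =
  Extrema.argmin f s candidates ,
  Extrema.argmin-all f Ps (all-filter P? (allFin n)) ,
  λ w Pw → lookup (Extrema.f[argmin]≤f[xs] s candidates) (∈-filter⁺ P? (∈-allFin w) Pw)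
  where
  candidates : List (Fin n)
  candidates = filter P? (allFin n)

block-constant-Laplacian⇒constant :
  ∀ {n p} (A : Graph n) (b : Fin n → Fin p) → StronglyConnected A →
  (f : Fin n → ℤ) (c : Fin p → ℤ) → (∀ v → applyQ A f v ≡ c (b v)) →
  (∀ v → ∃ λ u → b u ≡ b v × ∀ w → f u ≤ f w) →
  ∀ v w → f v ≡ f w
block-constant-Laplacian⇒constant {n} A b sc f c Qf≡c∘b block-min v w =
  trans (≡max v) (sym (≡max w))
  where
  m : Fin n
  m = proj₁ (argmax v f)
  m-max : ∀ u → f u ≤ f m
  m-max = proj₂ (argmax v f)
  max-closed : ∀ {x y} → f x ≡ f m → ℕ.NonZero (A x y) → f y ≡ f m
  max-closed {x} fx≡fm A[x,y]≢0 with block-min x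
  ... | u , bu≡bx , u-min = trans (max-propagates A f x-max Qx≤0 A[x,y]≢0) fx≡fm
    where
    x-max : ∀ z → f z ≤ f x
    x-max z = ℤP.≤-trans (m-max z) (ℤP.≤-reflexive (sym fx≡fm))
    Qu≡Qx : applyQ A f u ≡ applyQ A f x
    Qu≡Qx = trans (Qf≡c∘b u) (trans (cong c bu≡bx) (sym (Qf≡c∘b x)))
    Qx≤0 : applyQ A f x ≤ 0ℤ
    Qx≤0 = subst (_≤ 0ℤ) Qu≡Qx (applyQ-nonPos-at-min A f u-min)
  ≡max : ∀ x → f x ≡ f m
  ≡max x = Reach-preserves (λ x → f x ≡ f m) max-closed (sc m x) refl

module Equitable {n p} (A : Graph n) (b : Fin n → Fin p) (F : Fin p → Fin p → ℕ)
  (forward : (i j : Fin p) (v : Fin n) → b v ≡ i → edgesInto A b v j ≡ F i j) where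

  QP≡PQ̂ : ∀ (h : Fin p → ℤ) v → applyQ A (h ∘ b) v ≡ applyQ F h (b v)
  QP≡PQ̂ h v = begin
    applyQ A (h ∘ b) v
      ≡⟨ applyQ-as-differences A (h ∘ b) v ⟩
    sum (λ w → + A v w * (h (b v) - h (b w)))
      ≡⟨ sum-by-blocks A b v (λ j → h (b v) - h j) ⟩
    sum (λ j → + edgesInto A b v j * (h (b v) - h j))
      ≡⟨ sum-cong-≗ (λ j → cong (λ k → + k * (h (b v) - h j)) (forward (b v) j v refl)) ⟩
    sum (λ j → + F (b v) j * (h (b v) - h j))
      ≡⟨ applyQ-as-differences F h (b v) ⟨
    applyQ F h (b v)
      ∎
    where open ≡-Reasoning

  ρ-well-defined : ∀ x x′ → x ≈[ F ] x′ → applyP b x ≈[ A ] applyP b x′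
  ρ-well-defined x x′ (ŷ , x-x′≡Q̂ŷ) = ŷ ∘ b , λ v → begin
    applyP b x v - applyP b x′ v  ≡⟨ cong₂ _-_ (applyP-eval b x v) (applyP-eval b x′ v) ⟩
    x (b v) - x′ (b v)            ≡⟨ x-x′≡Q̂ŷ (b v) ⟩
    applyQ F ŷ (b v)              ≡⟨ QP≡PQ̂ ŷ v ⟨
    applyQ A (ŷ ∘ b) v            ∎
    where open ≡-Reasoning

  module _ (surj : Surjective b) (sc : StronglyConnected A) where

    Laplacian-block-constant⇒block-constant :
      (y : Fin n → ℤ) (z : Fin p → ℤ) → (∀ v → applyQ A y v ≡ z (b v)) →
      ∃ λ (g : Fin p → ℤ) → ∀ v → y v ≡ g (b v)
    Laplacian-block-constant⇒block-constant y z Qy≡z∘b =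
      g , λ v → ℤP.i-j≡0⇒i≡j (y v) (g (b v)) (trans (f-constant v (μ (b v))) (f∘μ≡0 (b v)))
      where
      block-argmin : ∀ j → ∃ λ m → b m ≡ j × ∀ w → b w ≡ j → y m ≤ y w
      block-argmin j = argmin-on (λ w → b w ≟ j) y (surj j)
      μ : Fin p → Fin n
      μ j = proj₁ (block-argmin j)
      g : Fin p → ℤ
      g j = y (μ j)
      f : Fin n → ℤ
      f v = y v - g (b v)
      f≥0 : ∀ w → 0ℤ ≤ f w
      f≥0 w = ℤP.i≤j⇒0≤j-i (proj₂ (proj₂ (block-argmin (b w))) w refl)
      f∘μ≡0 : ∀ j → f (μ j) ≡ 0ℤ
      f∘μ≡0 j = ℤP.i≡j⇒i-j≡0 (cong g (sym (proj₁ (proj₂ (block-argmin j)))))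
      Qf≡c∘b : ∀ v → applyQ A f v ≡ z (b v) - applyQ F g (b v)
      Qf≡c∘b v = trans (applyQ-distrib-minus A y (g ∘ b) v) (cong₂ _-_ (Qy≡z∘b v) (QP≡PQ̂ g v))
      f-constant : ∀ v w → f v ≡ f w
      f-constant = block-constant-Laplacian⇒constant A b sc f (λ j → z j - applyQ F g j) Qf≡c∘b
        λ v → μ (b v) , proj₁ (proj₂ (block-argmin (b v))) ,
              λ w → subst (_≤ f w) (sym (f∘μ≡0 (b v))) (f≥0 w)

    ρ-injective : ∀ x x′ → applyP b x ≈[ A ] applyP b x′ → x ≈[ F ] x′
    ρ-injective x x′ (y , Px-Px′≡Qy) = g , x-x′≡Q̂g
      where
      z : Fin p → ℤ
      z j = x j - x′ j
      Qy≡z∘b : ∀ v → applyQ A y v ≡ z (b v)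
      Qy≡z∘b v = trans (sym (Px-Px′≡Qy v)) (cong₂ _-_ (applyP-eval b x v) (applyP-eval b x′ v))
      g : Fin p → ℤ
      g = proj₁ (Laplacian-block-constant⇒block-constant y z Qy≡z∘b)
      y≡g∘b : ∀ v → y v ≡ g (b v)
      y≡g∘b = proj₂ (Laplacian-block-constant⇒block-constant y z Qy≡z∘b)
      x-x′≡Q̂g : ∀ j → z j ≡ applyQ F g j
      x-x′≡Q̂g j with surj j
      ... | s , refl = begin
        z (b s)             ≡⟨ Qy≡z∘b s ⟨
        applyQ A y s        ≡⟨ applyQ-cong A y≡g∘b s ⟩
        applyQ A (g ∘ b) s  ≡⟨ QP≡PQ̂ g s ⟩
        applyQ F g (b s)    ∎
        where open ≡-Reasoning

theorem6p1 : ∀ {n p} (A : Graph n) (b : Fin n → Fin p)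
               (F R : Fin p → Fin p → ℕ) →
               StronglyConnected A →
               IsEquitable A b F R →
               -- well-defined: respects Q̂ Z^p ↦ Q Z^V
               ((x x' : Fin p → ℤ) → x ≈[ F ] x' → applyP b x ≈[ A ] applyP b x')
               -- homomorphism
               × ((x y : Fin p → ℤ) (v : Fin n) →
                    applyP b (λ i → x i + y i) v ≡ applyP b x v + applyP b y v)
               -- injective
               × ((x x' : Fin p → ℤ) → applyP b x ≈[ A ] applyP b x' → x ≈[ F ] x')
theorem6p1 A b F R sc (surj , forward , _) =
  ρ-well-defined , applyP-distrib-+ b , ρ-injective surj sc
  where open Equitable A b F forward
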